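{- The system $\mathsf{IL}+\mathsf{HMP}$ does not derive Markov's principle $\mathsf{MP}$: not every instance $\lnot\lnot\exists\alpha\,P\rightarrow\exists\alpha\,P$, with $P$ an arbitrary propositional formula, is provable in $\mathsf{IL}+\mathsf{HMP}$.
   Context: Formulas of first-order logic are built from atomic formulas and $\bot$ using $\land,\lor,\rightarrow,\forall,\exists$, with $\lnot A:=A\rightarrow\bot$; a propositional formula is a quantifier-free formula. $\mathsf{IL}+\mathsf{HMP}$ is intuitionistic first-order natural deduction (with ex falso $\bot\rightarrow P$) extended with the axiom scheme $\mathsf{HMP}$: $\lnot\lnot\exists\alpha\,P\rightarrow\exists\alpha\,P$ for every propositional formula $P$ in which $\rightarrow$ does not occur. $\mathsf{MP}$ is the scheme $\lnot\lnot\exists\alpha\,P\rightarrow\exists\alpha\,P$ for every propositional formula $P$ (with no restriction on $\rightarrow$). -}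

module Defs where

open import Data.Nat using (ℕ; zero; suc)
open import Data.Fin using (Fin; zero; suc)
open import Data.Vec using (Vec; []; _∷_)
open import Data.List using (List; []; _∷_; map)
open import Data.List.Membership.Propositional using (_∈_)
open import Data.Empty using (⊥)
open import Data.Unit using (⊤)
open import Data.Product using (_×_)

-- First-order language (no equality): for every arity k, countably many
-- function symbols and countably many predicate symbols (indexed by ℕ).
-- Variables are well-scoped de Bruijn indices: Term n / Formula n have
-- at most n free variables.

data Term (n : ℕ) : Set where
  var : Fin n → Term n
  fun : (f k : ℕ) → Vec (Term n) k → Term n

data Formula (n : ℕ) : Set where
  rel  : (r k : ℕ) → Vec (Term n) k → Formula n
  `⊥   : Formula n
  _`∧_ : Formula n → Formula n → Formula n
  _`∨_ : Formula n → Formula n → Formula n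
  _`→_ : Formula n → Formula n → Formula n
  `∀   : Formula (suc n) → Formula n
  `∃   : Formula (suc n) → Formula n

infixr 6 _`∧_
infixr 5 _`∨_
infixr 4 _`→_

`¬ : ∀ {n} → Formula n → Formula n
`¬ A = A `→ `⊥

Ren : ℕ → ℕ → Set
Ren n m = Fin n → Fin m

liftRen : ∀ {n m} → Ren n m → Ren (suc n) (suc m)
liftRen ρ zero    = zero
liftRen ρ (suc i) = suc (ρ i)

mutual
  renT : ∀ {n m} → Ren n m → Term n → Term m
  renT ρ (var i)      = var (ρ i)
  renT ρ (fun f k ts) = fun f k (renTs ρ ts)

  renTs : ∀ {n m k} → Ren n m → Vec (Term n) k → Vec (Term m) k
  renTs ρ []       = []
  renTs ρ (t ∷ ts) = renT ρ t ∷ renTs ρ ts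

renF : ∀ {n m} → Ren n m → Formula n → Formula m
renF ρ (rel r k ts) = rel r k (renTs ρ ts)
renF ρ `⊥           = `⊥
renF ρ (A `∧ B)     = renF ρ A `∧ renF ρ B
renF ρ (A `∨ B)     = renF ρ A `∨ renF ρ B
renF ρ (A `→ B)     = renF ρ A `→ renF ρ B
renF ρ (`∀ A)       = `∀ (renF (liftRen ρ) A)
renF ρ (`∃ A)       = `∃ (renF (liftRen ρ) A)

wkF : ∀ {n} → Formula n → Formula (suc n)
wkF = renF suc

Sub : ℕ → ℕ → Set
Sub n m = Fin n → Term m

liftSub : ∀ {n m} → Sub n m → Sub (suc n) (suc m)
liftSub σ zero    = var zero
liftSub σ (suc i) = renT suc (σ i)

mutual
  subT : ∀ {n m} → Sub n m → Term n → Term m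
  subT σ (var i)      = σ i
  subT σ (fun f k ts) = fun f k (subTs σ ts)

  subTs : ∀ {n m k} → Sub n m → Vec (Term n) k → Vec (Term m) k
  subTs σ []       = []
  subTs σ (t ∷ ts) = subT σ t ∷ subTs σ ts

subF : ∀ {n m} → Sub n m → Formula n → Formula m
subF σ (rel r k ts) = rel r k (subTs σ ts)
subF σ `⊥           = `⊥
subF σ (A `∧ B)     = subF σ A `∧ subF σ B
subF σ (A `∨ B)     = subF σ A `∨ subF σ B
subF σ (A `→ B)     = subF σ A `→ subF σ B
subF σ (`∀ A)       = `∀ (subF (liftSub σ) A)
subF σ (`∃ A)       = `∃ (subF (liftSub σ) A)

sub0 : ∀ {n} → Term n → Sub (suc n) n
sub0 t zero    = t
sub0 t (suc i) = var i

_[_] : ∀ {n} → Formula (suc n) → Term n → Formula n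
A [ t ] = subF (sub0 t) A

Propositional : ∀ {n} → Formula n → Set
Propositional (rel r k ts) = ⊤
Propositional `⊥           = ⊤
Propositional (A `∧ B)     = Propositional A × Propositional B
Propositional (A `∨ B)     = Propositional A × Propositional B
Propositional (A `→ B)     = Propositional A × Propositional B
Propositional (`∀ A)       = ⊥
Propositional (`∃ A)       = ⊥

PropNoImp : ∀ {n} → Formula n → Set
PropNoImp (rel r k ts) = ⊤
PropNoImp `⊥           = ⊤
PropNoImp (A `∧ B)     = PropNoImp A × PropNoImp B
PropNoImp (A `∨ B)     = PropNoImp A × PropNoImp B
PropNoImp (A `→ B)     = ⊥
PropNoImp (`∀ A)       = ⊥
PropNoImp (`∃ A)       = ⊥

MPinst : ∀ {n} → Formula (suc n) → Formula n
MPinst P = `¬ (`¬ (`∃ P)) `→ `∃ P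

infix 2 _⊢_
data _⊢_ : {n : ℕ} → List (Formula n) → Formula n → Set where
  hyp  : ∀ {n} {Γ : List (Formula n)} {A} → A ∈ Γ → Γ ⊢ A
  ⊥E   : ∀ {n} {Γ : List (Formula n)} {A} → Γ ⊢ `⊥ → Γ ⊢ A
  ∧I   : ∀ {n} {Γ : List (Formula n)} {A B} → Γ ⊢ A → Γ ⊢ B → Γ ⊢ A `∧ B
  ∧E₁  : ∀ {n} {Γ : List (Formula n)} {A B} → Γ ⊢ A `∧ B → Γ ⊢ A
  ∧E₂  : ∀ {n} {Γ : List (Formula n)} {A B} → Γ ⊢ A `∧ B → Γ ⊢ B
  ∨I₁  : ∀ {n} {Γ : List (Formula n)} {A B} → Γ ⊢ A → Γ ⊢ A `∨ B
  ∨I₂  : ∀ {n} {Γ : List (Formula n)} {A B} → Γ ⊢ B → Γ ⊢ A `∨ B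
  ∨E   : ∀ {n} {Γ : List (Formula n)} {A B C} →
         Γ ⊢ A `∨ B → (A ∷ Γ) ⊢ C → (B ∷ Γ) ⊢ C → Γ ⊢ C
  →I   : ∀ {n} {Γ : List (Formula n)} {A B} → (A ∷ Γ) ⊢ B → Γ ⊢ A `→ B
  →E   : ∀ {n} {Γ : List (Formula n)} {A B} → Γ ⊢ A `→ B → Γ ⊢ A → Γ ⊢ B
  ∀I   : ∀ {n} {Γ : List (Formula n)} {A : Formula (suc n)} →
         map wkF Γ ⊢ A → Γ ⊢ `∀ A
  ∀E   : ∀ {n} {Γ : List (Formula n)} {A : Formula (suc n)} →
         Γ ⊢ `∀ A → (t : Term n) → Γ ⊢ A [ t ]
  ∃I   : ∀ {n} {Γ : List (Formula n)} {A : Formula (suc n)} →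
         (t : Term n) → Γ ⊢ A [ t ] → Γ ⊢ `∃ A
  ∃E   : ∀ {n} {Γ : List (Formula n)} {A : Formula (suc n)} {C : Formula n} →
         Γ ⊢ `∃ A → (A ∷ map wkF Γ) ⊢ wkF C → Γ ⊢ C
  hmp  : ∀ {n} {Γ : List (Formula n)} (P : Formula (suc n)) →
         PropNoImp P → Γ ⊢ MPinst P

Provable : ∀ {n} → Formula n → Set
Provable A = [] ⊢ A

-- Erase quantifiers and read the remaining propositional shape in Kripke
-- models whose atoms all have the same truth value.  In the model with a root
-- below two leaves, atoms true only in the left leaf, an implication-free P is
-- false at the root and the right leaf and decidable at the left leaf, so every
-- HMP instance is forced, so IL + HMP is sound for this model.  But Q ∨ ¬Q
-- fails at the root, so ∃α(Q ∨ ¬Q) is not derivable although ¬¬∃α(Q ∨ ¬Q) is.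
module Submission where

open import Defs
open import Data.Nat using (ℕ; suc)
open import Data.Fin using (Fin)
open import Data.Vec using ([])
open import Data.List using (List; []; _∷_; map)
open import Data.List.Relation.Unary.Any using (here; there)
open import Data.List.Relation.Unary.All as All using (All; []; _∷_)
open import Data.List.Relation.Unary.All.Properties using (map⁺)
open import Data.Product using (Σ; _×_; _,_; proj₁; proj₂)
open import Data.Sum using (_⊎_; inj₁; inj₂)
open import Data.Empty using (⊥; ⊥-elim)
open import Relation.Nullary using (¬_; Dec; yes; no)
open import Relation.Binary.PropositionalEquality using (_≡_; refl; cong₂; subst; sym)

data Shape : Set where
  atom ⊥ˢ         : Shape
  _∧ˢ_ _∨ˢ_ _⇒ˢ_ : Shape → Shape → Shape

shape : ∀ {n} → Formula n → Shape
shape (rel _ _ _) = atom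
shape `⊥          = ⊥ˢ
shape (A `∧ B)    = shape A ∧ˢ shape B
shape (A `∨ B)    = shape A ∨ˢ shape B
shape (A `→ B)    = shape A ⇒ˢ shape B
shape (`∀ A)      = shape A
shape (`∃ A)      = shape A

shape-renF : ∀ {n m} (ρ : Ren n m) (A : Formula n) → shape (renF ρ A) ≡ shape A
shape-renF ρ (rel _ _ _) = refl
shape-renF ρ `⊥          = refl
shape-renF ρ (A `∧ B)    = cong₂ _∧ˢ_ (shape-renF ρ A) (shape-renF ρ B)
shape-renF ρ (A `∨ B)    = cong₂ _∨ˢ_ (shape-renF ρ A) (shape-renF ρ B)
shape-renF ρ (A `→ B)    = cong₂ _⇒ˢ_ (shape-renF ρ A) (shape-renF ρ B)
shape-renF ρ (`∀ A)      = shape-renF (liftRen ρ) A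
shape-renF ρ (`∃ A)      = shape-renF (liftRen ρ) A

shape-subF : ∀ {n m} (σ : Sub n m) (A : Formula n) → shape (subF σ A) ≡ shape A
shape-subF σ (rel _ _ _) = refl
shape-subF σ `⊥          = refl
shape-subF σ (A `∧ B)    = cong₂ _∧ˢ_ (shape-subF σ A) (shape-subF σ B)
shape-subF σ (A `∨ B)    = cong₂ _∨ˢ_ (shape-subF σ A) (shape-subF σ B)
shape-subF σ (A `→ B)    = cong₂ _⇒ˢ_ (shape-subF σ A) (shape-subF σ B)
shape-subF σ (`∀ A)      = shape-subF (liftSub σ) A
shape-subF σ (`∃ A)      = shape-subF (liftSub σ) A

record KripkeModel : Set₁ where
  field
    World     : Set
    _≼_       : World → World → Set
    ≼-refl    : ∀ {w} → w ≼ w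
    ≼-trans   : ∀ {u v w} → u ≼ v → v ≼ w → u ≼ w
    Atom      : World → Set
    Atom-mono : ∀ {v w} → v ≼ w → Atom v → Atom w

module Forcing (K : KripkeModel) where
  open KripkeModel K

  infix 3 _⊩ˢ_ _⊩_

  _⊩ˢ_ : World → Shape → Set
  w ⊩ˢ atom   = Atom w
  w ⊩ˢ ⊥ˢ     = ⊥
  w ⊩ˢ a ∧ˢ b = w ⊩ˢ a × w ⊩ˢ b
  w ⊩ˢ a ∨ˢ b = w ⊩ˢ a ⊎ w ⊩ˢ b
  w ⊩ˢ a ⇒ˢ b = ∀ {v} → w ≼ v → v ⊩ˢ a → v ⊩ˢ b

  _⊩_ : ∀ {n} → World → Formula n → Set
  w ⊩ A = w ⊩ˢ shape A

  ⊩ˢ-mono : ∀ {v w} a → v ≼ w → v ⊩ˢ a → w ⊩ˢ a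
  ⊩ˢ-mono atom     v≼w x        = Atom-mono v≼w x
  ⊩ˢ-mono (a ∧ˢ b) v≼w (x , y)  = ⊩ˢ-mono a v≼w x , ⊩ˢ-mono b v≼w y
  ⊩ˢ-mono (a ∨ˢ b) v≼w (inj₁ x) = inj₁ (⊩ˢ-mono a v≼w x)
  ⊩ˢ-mono (a ∨ˢ b) v≼w (inj₂ y) = inj₂ (⊩ˢ-mono b v≼w y)
  ⊩ˢ-mono (a ⇒ˢ b) v≼w f        = λ w≼u → f (≼-trans v≼w w≼u)

  ⊩-wkF : ∀ {n w} (A : Formula n) → w ⊩ wkF A → w ⊩ A
  ⊩-wkF {w = w} A = subst (w ⊩ˢ_) (shape-renF Fin.suc A)

  wkF-⊩ : ∀ {n w} (A : Formula n) → w ⊩ A → w ⊩ wkF A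
  wkF-⊩ {w = w} A = subst (w ⊩ˢ_) (sym (shape-renF Fin.suc A))

  ⊩-inst : ∀ {n w} (A : Formula (suc n)) t → w ⊩ A [ t ] → w ⊩ A
  ⊩-inst {w = w} A t = subst (w ⊩ˢ_) (shape-subF (sub0 t) A)

  inst-⊩ : ∀ {n w} (A : Formula (suc n)) t → w ⊩ A → w ⊩ A [ t ]
  inst-⊩ {w = w} A t = subst (w ⊩ˢ_) (sym (shape-subF (sub0 t) A))

  ⊩-dec : ∀ {n w} → Dec (Atom w) → (P : Formula n) → PropNoImp P → Dec (w ⊩ P)
  ⊩-dec atom? (rel _ _ _) _ = atom?
  ⊩-dec atom? `⊥          _ = no λ ()
  ⊩-dec atom? (A `∧ B) (noImpA , noImpB)
    with ⊩-dec atom? A noImpA | ⊩-dec atom? B noImpB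
  ... | yes x | yes y = yes (x , y)
  ... | no ¬x | _     = no (λ xy → ¬x (proj₁ xy))
  ... | _     | no ¬y = no (λ xy → ¬y (proj₂ xy))
  ⊩-dec atom? (A `∨ B) (noImpA , noImpB)
    with ⊩-dec atom? A noImpA | ⊩-dec atom? B noImpB
  ... | yes x | _     = yes (inj₁ x)
  ... | _     | yes y = yes (inj₂ y)
  ... | no ¬x | no ¬y = no λ { (inj₁ x) → ¬x x ; (inj₂ y) → ¬y y }

  noImp-false : ∀ {n w} → ¬ Atom w → (P : Formula n) → PropNoImp P → ¬ (w ⊩ P)
  noImp-false ¬atom (rel _ _ _) _                 = ¬atom
  noImp-false ¬atom (A `∧ B)    (noImpA , _)      (x , _)  = noImp-false ¬atom A noImpA x
  noImp-false ¬atom (A `∨ B)    (noImpA , _)      (inj₁ x) = noImp-false ¬atom A noImpA x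
  noImp-false ¬atom (A `∨ B)    (_      , noImpB) (inj₂ y) = noImp-false ¬atom B noImpB y

  module Soundness
    (hmp-forced : ∀ {n w} (P : Formula (suc n)) → PropNoImp P → w ⊩ MPinst P) where

    wk-All : ∀ {n w} {Γ : List (Formula n)} → All (w ⊩_) Γ → All (w ⊩_) (map wkF Γ)
    wk-All ⊩Γ = map⁺ (All.map (λ {A} → wkF-⊩ A) ⊩Γ)

    sound : ∀ {n} {Γ : List (Formula n)} {A w} → Γ ⊢ A → All (w ⊩_) Γ → w ⊩ A
    sound (hyp A∈Γ)        ⊩Γ = All.lookup ⊩Γ A∈Γ
    sound (⊥E d)           ⊩Γ = ⊥-elim (sound d ⊩Γ)
    sound (∧I d e)         ⊩Γ = sound d ⊩Γ , sound e ⊩Γ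
    sound (∧E₁ d)          ⊩Γ = proj₁ (sound d ⊩Γ)
    sound (∧E₂ d)          ⊩Γ = proj₂ (sound d ⊩Γ)
    sound (∨I₁ d)          ⊩Γ = inj₁ (sound d ⊩Γ)
    sound (∨I₂ d)          ⊩Γ = inj₂ (sound d ⊩Γ)
    sound (∨E d e f)       ⊩Γ with sound d ⊩Γ
    ... | inj₁ x = sound e (x ∷ ⊩Γ)
    ... | inj₂ y = sound f (y ∷ ⊩Γ)
    sound (→I d)           ⊩Γ = λ w≼v x → sound d (x ∷ All.map (λ {A} → ⊩ˢ-mono (shape A) w≼v) ⊩Γ)
    sound (→E d e)         ⊩Γ = sound d ⊩Γ ≼-refl (sound e ⊩Γ)
    sound (∀I d)           ⊩Γ = sound d (wk-All ⊩Γ)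
    sound (∀E {A = A} d t) ⊩Γ = inst-⊩ A t (sound d ⊩Γ)
    sound (∃I {A = A} t d) ⊩Γ = ⊩-inst A t (sound d ⊩Γ)
    sound (∃E {C = C} d e) ⊩Γ = ⊩-wkF C (sound e (sound d ⊩Γ ∷ wk-All ⊩Γ))
    sound (hmp P noImp)    _  = hmp-forced P noImp

data V : Set where
  root left right : V

data _≼ⱽ_ : V → V → Set where
  root≼ : ∀ {w} → root ≼ⱽ w
  ≼ⱽ-refl : ∀ {w} → w ≼ⱽ w

≼ⱽ-trans : ∀ {u v w} → u ≼ⱽ v → v ≼ⱽ w → u ≼ⱽ w
≼ⱽ-trans root≼   _ = root≼
≼ⱽ-trans ≼ⱽ-refl q = q

data IsLeft : V → Set where
  left : IsLeft left

IsLeft-mono : ∀ {v w} → v ≼ⱽ w → IsLeft v → IsLeft w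
IsLeft-mono ≼ⱽ-refl x = x

V-model : KripkeModel
V-model = record
  { World     = V
  ; _≼_       = _≼ⱽ_
  ; ≼-refl    = ≼ⱽ-refl
  ; ≼-trans   = ≼ⱽ-trans
  ; Atom      = IsLeft
  ; Atom-mono = IsLeft-mono
  }

open Forcing V-model

right-⊩-¬ : ∀ {n} (P : Formula n) → PropNoImp P → right ⊩ `¬ P
right-⊩-¬ P noImp ≼ⱽ-refl = noImp-false (λ ()) P noImp

left-¬-⊩-¬ : ∀ {n} (P : Formula n) → ¬ (left ⊩ P) → left ⊩ `¬ P
left-¬-⊩-¬ P ¬x ≼ⱽ-refl = ¬x

V-hmp : ∀ {n w} (P : Formula (suc n)) → PropNoImp P → w ⊩ MPinst P
V-hmp P noImp {v} _ = forced v
  where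
  forced : ∀ v → v ⊩ `¬ (`¬ (`∃ P)) → v ⊩ `∃ P
  forced root  ¬¬∃P = ⊥-elim (¬¬∃P root≼ (right-⊩-¬ P noImp))
  forced right ¬¬∃P = ⊥-elim (¬¬∃P ≼ⱽ-refl (right-⊩-¬ P noImp))
  forced left  ¬¬∃P with ⊩-dec (yes left) P noImp
  ... | yes x = x
  ... | no ¬x = ⊥-elim (¬¬∃P ≼ⱽ-refl (left-¬-⊩-¬ P ¬x))

open Soundness V-hmp

Q : Formula 1
Q = rel 0 0 []

excluded-middle : Formula 1
excluded-middle = Q `∨ `¬ Q

¬¬∃-excluded-middle : Provable (`¬ (`¬ (`∃ excluded-middle)))
¬¬∃-excluded-middle =
  →I (→E (hyp (here refl))
         (∃I c (∨I₂ (→I (→E (hyp (there (here refl)))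
                             (∃I c (∨I₁ (hyp (here refl)))))))))
  where
  c : Term 0
  c = fun 0 0 []

∃-excluded-middle-unprovable : ¬ Provable (`∃ excluded-middle)
∃-excluded-middle-unprovable d with sound {w = root} d []
... | inj₁ ()
... | inj₂ ¬Q = ¬Q root≼ left

proposition2p5 : Σ ℕ (λ n → Σ (Formula (suc n)) (λ P →
                   Propositional P × ¬ Provable (MPinst P)))
proposition2p5 = 0 , excluded-middle , (_ , _ , _) , λ mp →
  ∃-excluded-middle-unprovable (→E mp ¬¬∃-excluded-middle)
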